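{- If $G$ is a connected bipartite graph of order $n$ with minimum degree $1$, then ${\rm I}_e(G)\leq n-1$.
   Context: All graphs are finite and simple. A graph is locally irregular if no two adjacent vertices have the same degree. For a graph $G=(V,E)$, a set $S\subseteq E$ is an edge-irregulator of $G$ if $G-S$ is locally irregular, and ${\rm I}_e(G)$ is the minimum cardinality of an edge-irregulator of $G$. -}

module Defs where

open import Data.Nat using (ℕ; zero; suc; _+_; _<ᵇ_; _≤_)
open import Data.Fin using (Fin; toℕ)
import Data.Fin as F
open import Data.Bool using (Bool; true; false; if_then_else_; _∧_; not)
open import Data.Product using (Σ; ∃; _×_)
open import Relation.Binary.PropositionalEquality using (_≡_; _≢_)

sumFin : ∀ {n} → (Fin n → ℕ) → ℕ
sumFin {zero}  f = 0
sumFin {suc n} f = f F.zero + sumFin {n} (λ i → f (F.suc i))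

record Graph (n : ℕ) : Set where
  field
    adj    : Fin n → Fin n → Bool
    sym    : ∀ i j → adj i j ≡ adj j i
    irrefl : ∀ i → adj i i ≡ false
open Graph public

deg : ∀ {n} → (Fin n → Fin n → Bool) → Fin n → ℕ
deg a v = sumFin (λ j → if a v j then 1 else 0)

degree : ∀ {n} → Graph n → Fin n → ℕ
degree G = deg (adj G)

LocallyIrregular : ∀ {n} → (Fin n → Fin n → Bool) → Set
LocallyIrregular a = ∀ i j → a i j ≡ true → deg a i ≢ deg a j

MinDegreeOne : ∀ {n} → Graph n → Set
MinDegreeOne G = (∀ v → 1 ≤ degree G v) × ∃ (λ v → degree G v ≡ 1)

data Reach {n} (G : Graph n) : Fin n → Fin n → Set where
  here : ∀ {u} → Reach G u u
  step : ∀ {u w v} → adj G u w ≡ true → Reach G w v → Reach G u v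

Connected : ∀ {n} → Graph n → Set
Connected G = ∀ u v → Reach G u v

Bipartite : ∀ {n} → Graph n → Set
Bipartite {n} G = Σ (Fin n → Bool) (λ c → ∀ i j → adj G i j ≡ true → c i ≢ c j)

record EdgeSet {n} (G : Graph n) : Set where
  field
    mem    : Fin n → Fin n → Bool
    symS   : ∀ i j → mem i j ≡ mem j i
    subset : ∀ i j → mem i j ≡ true → adj G i j ≡ true
open EdgeSet public

card : ∀ {n} {G : Graph n} → EdgeSet G → ℕ
card S = sumFin (λ i → sumFin (λ j → if (toℕ i <ᵇ toℕ j) ∧ mem S i j then 1 else 0))

minus : ∀ {n} (G : Graph n) → EdgeSet G → Fin n → Fin n → Bool
minus G S i j = adj G i j ∧ not (mem S i j)

IsEdgeIrregulator : ∀ {n} (G : Graph n) → EdgeSet G → Set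
IsEdgeIrregulator G S = LocallyIrregular (minus G S)

-- I_e(G) ≤ k  (I_e(G) is the minimum size of an edge-irregulator; one always
-- exists, namely S = E(G))
IeAtMost : ∀ {n} → Graph n → ℕ → Set
IeAtMost G k = Σ (EdgeSet G) (λ S → IsEdgeIrregulator G S × card S ≤ k)

{-# OPTIONS --safe #-}
-- Root a breadth-first spanning tree at a vertex v of degree 1, and give every
-- vertex the parity 1 if it lies in the colour class of v and 0 otherwise.
-- Working from the leaves up, delete the edge from a non-root vertex to its
-- parent exactly when this is needed for the remaining degree of that vertex to
-- have its prescribed parity; at most n - 1 edges are deleted.  The root keeps
-- degree 0 or 1, which also agrees with its parity.  Adjacent vertices lie in
-- different colour classes, so their remaining degrees have different parities.
module Submission where

open import Defs renaming (sym to adj-sym)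
open import Data.Nat using (ℕ; zero; suc; _+_; _*_; _∸_; _≤_; _<_; _<ᵇ_; z≤n; s≤s; parity)
open import Data.Nat.Properties
  using (≤-refl; ≤-trans; ≤-reflexive; ≤-antisym; <-asym; <-≤-trans; +-mono-≤; m≤m+n; m≤n+m;
         +-identityʳ; *-zeroʳ; *-identityʳ; ∸-monoʳ-<; <ᵇ⇒<; +-commutativeSemigroup; module ≤-Reasoning)
open import Algebra.Properties.CommutativeSemigroup +-commutativeSemigroup using (interchange)
open import Data.Fin using (Fin; zero; suc; toℕ)
open import Data.Fin.Properties using (_≟_; any?)
open import Data.Bool using (Bool; true; false; if_then_else_; _∧_; _∨_; not)
open import Data.Bool.Properties using (∨-comm; ∧-conicalˡ; T-≡) renaming (_≟_ to _≟ᵇ_)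
open import Data.Parity using (Parity; 0ℙ; 1ℙ) renaming (_+_ to _⊕_)
open import Data.Parity.Properties using (+-homo-+; p+p≡0ℙ) renaming (+-assoc to ⊕-assoc; +-comm to ⊕-comm; +-identityʳ to ⊕-identityʳ)
open import Data.Product using (∃; _×_; _,_; proj₁; proj₂)
open import Data.Sum using ([_,_]′)
open import Data.Empty using (⊥; ⊥-elim)
open import Function using (Equivalence)
open import Relation.Nullary using (Dec; yes; no; does; contradiction)
open import Relation.Nullary.Decidable using (_×-dec_; dec-false; toSum)
open import Relation.Binary.PropositionalEquality

ind : Bool → ℕ
ind b = if b then 1 else 0

ind-∧ : ∀ a b → ind (a ∧ b) ≤ ind a
ind-∧ true  true  = ≤-refl
ind-∧ true  false = z≤n
ind-∧ false _     = z≤n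

ind-∨ : ∀ a b → (a ≡ true → b ≡ true → ⊥) → ind (a ∨ b) ≡ ind a + ind b
ind-∨ true  true  disjoint = ⊥-elim (disjoint refl refl)
ind-∨ true  false _        = refl
ind-∨ false _     _        = refl

ind-∧-∨ : ∀ a b c → ind (a ∧ (b ∨ c)) ≤ ind (a ∧ b) + ind (a ∧ c)
ind-∧-∨ true  true  _ = s≤s z≤n
ind-∧-∨ true  false _ = ≤-refl
ind-∧-∨ false _     _ = z≤n

ind-∧-disjoint : ∀ a b c → (a ≡ true → b ≡ true → ⊥) → ind (a ∧ c) + ind (b ∧ c) ≤ ind c
ind-∧-disjoint true  true  _     disjoint = ⊥-elim (disjoint refl refl)
ind-∧-disjoint true  false true  _ = ≤-refl
ind-∧-disjoint true  false false _ = z≤n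
ind-∧-disjoint false true  true  _ = ≤-refl
ind-∧-disjoint false true  false _ = z≤n
ind-∧-disjoint false false _     _ = z≤n

ind-split : ∀ a s → (s ≡ true → a ≡ true) → ind a ≡ ind (a ∧ not s) + ind s
ind-split true  true  _ = refl
ind-split true  false _ = refl
ind-split false true  s⇒a = contradiction (s⇒a refl) λ ()
ind-split false false _ = refl

<ᵇ-asym : ∀ m n → (m <ᵇ n) ≡ true → (n <ᵇ m) ≡ true → ⊥
<ᵇ-asym m n m<n n<m = <-asym (<ᵇ⇒< m n (Equivalence.from T-≡ m<n)) (<ᵇ⇒< n m (Equivalence.from T-≡ n<m))

sumFin-cong : ∀ {m} {f g : Fin m → ℕ} → (∀ i → f i ≡ g i) → sumFin f ≡ sumFin g
sumFin-cong {zero}  _  = refl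
sumFin-cong {suc m} eq = cong₂ _+_ (eq zero) (sumFin-cong (λ i → eq (suc i)))

sumFin-mono : ∀ {m} {f g : Fin m → ℕ} → (∀ i → f i ≤ g i) → sumFin f ≤ sumFin g
sumFin-mono {zero}  _  = z≤n
sumFin-mono {suc m} le = +-mono-≤ (le zero) (sumFin-mono (λ i → le (suc i)))

sumFin-+ : ∀ {m} (f g : Fin m → ℕ) → sumFin (λ i → f i + g i) ≡ sumFin f + sumFin g
sumFin-+ {zero}  f g = refl
sumFin-+ {suc m} f g =
  trans (cong (f zero + g zero +_) (sumFin-+ (λ i → f (suc i)) (λ i → g (suc i))))
        (interchange (f zero) (g zero) _ _)

sumFin-const : ∀ m c → sumFin {m} (λ _ → c) ≡ m * c
sumFin-const zero    c = refl
sumFin-const (suc m) c = cong (c +_) (sumFin-const m c)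

sumFin-zero : ∀ m → sumFin {m} (λ _ → 0) ≡ 0
sumFin-zero m = trans (sumFin-const m 0) (*-zeroʳ m)

sumFin-comm : ∀ {m k} (f : Fin m → Fin k → ℕ) →
              sumFin (λ i → sumFin (f i)) ≡ sumFin (λ j → sumFin (λ i → f i j))
sumFin-comm {zero}  {k} f = sym (sumFin-zero k)
sumFin-comm {suc m} f =
  trans (cong (sumFin (f zero) +_) (sumFin-comm (λ i → f (suc i))))
        (sym (sumFin-+ (f zero) _))

≤-sumFin : ∀ {m} (f : Fin m → ℕ) i → f i ≤ sumFin f
≤-sumFin f zero    = m≤m+n _ _
≤-sumFin f (suc i) = ≤-trans (≤-sumFin (λ k → f (suc k)) i) (m≤n+m _ _)

sumFin-ind-≟ : ∀ {m} (k : Fin m) b → sumFin (λ j → ind (does (k ≟ j) ∧ b)) ≡ ind b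
sumFin-ind-≟ {suc m} zero b = trans (cong (ind b +_) (sumFin-zero m)) (+-identityʳ (ind b))
sumFin-ind-≟ (suc k) b = sumFin-ind-≟ k b

sumFin-ind-≢ : ∀ {m} (k : Fin m) → sumFin (λ i → ind (not (does (i ≟ k)))) ≡ m ∸ 1
sumFin-ind-≢ {suc m}       zero    = trans (sumFin-const m 1) (*-identityʳ m)
sumFin-ind-≢ {suc (suc m)} (suc k) = cong suc (sumFin-ind-≢ k)

sumFin² : ∀ {m} → (Fin m → Fin m → ℕ) → ℕ
sumFin² f = sumFin (λ i → sumFin (f i))

sumFin²-mono : ∀ {m} {f g : Fin m → Fin m → ℕ} → (∀ i j → f i j ≤ g i j) → sumFin² f ≤ sumFin² g
sumFin²-mono le = sumFin-mono (λ i → sumFin-mono (le i))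

sumFin²-+ : ∀ {m} (f g : Fin m → Fin m → ℕ) →
            sumFin² (λ i j → f i j + g i j) ≡ sumFin² f + sumFin² g
sumFin²-+ f g = trans (sumFin-cong (λ i → sumFin-+ (f i) (g i)))
                      (sumFin-+ (λ i → sumFin (f i)) (λ i → sumFin (g i)))

p+q+q≡p : ∀ p q → p ⊕ q ⊕ q ≡ p
p+q+q≡p p q = trans (⊕-assoc p q q) (trans (cong (p ⊕_) (p+p≡0ℙ q)) (⊕-identityʳ p))

odd : Parity → Bool
odd 0ℙ = false
odd 1ℙ = true

parity-ind-odd : ∀ p → parity (ind (odd p)) ≡ p
parity-ind-odd 0ℙ = refl
parity-ind-odd 1ℙ = refl

module _ {n} (G : Graph n) (S : EdgeSet G) where

  minus⊆adj : ∀ {i j} → minus G S i j ≡ true → adj G i j ≡ true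
  minus⊆adj {i} {j} = ∧-conicalˡ (adj G i j) _

  minus-sym : ∀ i j → minus G S i j ≡ minus G S j i
  minus-sym i j = cong₂ (λ a s → a ∧ not s) (adj-sym G i j) (symS S i j)

  degree-minus : ∀ w → degree G w ≡ deg (minus G S) w + deg (mem S) w
  degree-minus w = trans (sumFin-cong (λ j → ind-split (adj G w j) (mem S w j) (subset S w j)))
                         (sumFin-+ (λ j → ind (minus G S w j)) (λ j → ind (mem S w j)))

  parity-deg-minus : ∀ w → parity (deg (minus G S) w) ≡ parity (degree G w) ⊕ parity (deg (mem S) w)
  parity-deg-minus w = begin
    parity d                          ≡⟨ p+q+q≡p (parity d) (parity s) ⟨
    parity d ⊕ parity s ⊕ parity s    ≡⟨ cong (_⊕ parity s) (+-homo-+ d s) ⟨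
    parity (d + s) ⊕ parity s         ≡⟨ cong (λ k → parity k ⊕ parity s) (degree-minus w) ⟨
    parity (degree G w) ⊕ parity s    ∎
    where
    open ≡-Reasoning
    d = deg (minus G S) w
    s = deg (mem S) w

  deg-minus-pendant : ∀ {v j} → degree G v ≡ 1 → minus G S v j ≡ true → deg (minus G S) v ≡ 1
  deg-minus-pendant {v} {j} deg-v≡1 vj =
    ≤-antisym (≤-trans (m≤m+n _ _) (≤-reflexive (trans (sym (degree-minus v)) deg-v≡1)))
              (subst (λ b → ind b ≤ deg (minus G S) v) vj (≤-sumFin (λ k → ind (minus G S v k)) j))

  card-≤-arcs : (A : Fin n → Fin n → Bool) → (∀ i j → mem S i j ≡ A i j ∨ A j i) →
                card S ≤ sumFin² (λ i j → ind (A i j))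
  card-≤-arcs A mem≡ = begin
    card S
      ≤⟨ sumFin²-mono (λ i j → ≤-trans (≤-reflexive (cong (λ b → ind (lt i j ∧ b)) (mem≡ i j)))
                                       (ind-∧-∨ (lt i j) (A i j) (A j i))) ⟩
    sumFin² (λ i j → ind (lt i j ∧ A i j) + ind (lt i j ∧ A j i))
      ≡⟨ sumFin²-+ {n} _ _ ⟩
    sumFin² (λ i j → ind (lt i j ∧ A i j)) + sumFin² (λ i j → ind (lt i j ∧ A j i))
      ≡⟨ cong (sumFin² (λ i j → ind (lt i j ∧ A i j)) +_) (sumFin-comm (λ i j → ind (lt i j ∧ A j i))) ⟩
    sumFin² (λ i j → ind (lt i j ∧ A i j)) + sumFin² (λ i j → ind (lt j i ∧ A i j))
      ≡⟨ sumFin²-+ {n} _ _ ⟨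
    sumFin² (λ i j → ind (lt i j ∧ A i j) + ind (lt j i ∧ A i j))
      ≤⟨ sumFin²-mono (λ i j → ind-∧-disjoint (lt i j) (lt j i) (A i j) (<ᵇ-asym (toℕ i) (toℕ j))) ⟩
    sumFin² (λ i j → ind (A i j))
      ∎
    where
    open ≤-Reasoning
    lt : Fin n → Fin n → Bool
    lt i j = toℕ i <ᵇ toℕ j

irregular-by-parity : ∀ {n} (a : Fin n → Fin n → Bool) (τ : Fin n → Parity) →
  (∀ i j → a i j ≡ a j i) → (∀ i j → a i j ≡ true → τ i ≢ τ j) →
  (∀ i j → a i j ≡ true → parity (deg a i) ≡ τ i) → LocallyIrregular a
irregular-by-parity a τ a-sym τ-proper deg-parity i j ij deg≡ =
  τ-proper i j ij (trans (sym (deg-parity i j ij))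
                  (trans (cong parity deg≡) (deg-parity j i (trans (a-sym j i) ij))))

record Least (P : ℕ → Set) : Set where
  field
    value   : ℕ
    holds   : P value
    minimal : ∀ {k} → P k → value ≤ k

least : ∀ {P : ℕ → Set} → (∀ k → Dec (P k)) → ∀ {k} → P k → Least P
least P? {zero} p = record { value = 0 ; holds = p ; minimal = λ _ → z≤n }
least P? {suc k} p with P? 0
... | yes p₀ = record { value = 0 ; holds = p₀ ; minimal = λ _ → z≤n }
... | no ¬p₀ = record
  { value   = suc value
  ; holds   = holds
  ; minimal = λ { {zero} p₀ → contradiction p₀ ¬p₀ ; {suc j} pj → s≤s (minimal pj) }
  }
  where open Least (least (λ j → P? (suc j)) p)

Walk : ∀ {n} → Graph n → ℕ → Fin n → Fin n → Set
Walk G zero    u v = u ≡ v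
Walk G (suc k) u v = ∃ λ x → adj G u x ≡ true × Walk G k x v

walk? : ∀ {n} (G : Graph n) k u v → Dec (Walk G k u v)
walk? G zero    u v = u ≟ v
walk? G (suc k) u v = any? (λ x → (adj G u x ≟ᵇ true) ×-dec walk? G k x v)

reach⇒walk : ∀ {n} {G : Graph n} {u v} → Reach G u v → ∃ λ k → Walk G k u v
reach⇒walk here       = 0 , refl
reach⇒walk (step a r) = let k , walk = reach⇒walk r in suc k , _ , a , walk

record RootedSpanningTree {n} (G : Graph n) (root : Fin n) : Set where
  field
    parent      : Fin n → Fin n
    rank        : Fin n → ℕ
    parent-adj  : ∀ {w} → w ≢ root → adj G w (parent w) ≡ true
    rank-parent : ∀ {w} → w ≢ root → rank w < rank (parent w)

module BreadthFirst {n} (G : Graph n) (root : Fin n) (reach : ∀ u → Reach G u root) where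

  toRoot : ∀ u → Least (λ k → Walk G k u root)
  toRoot u = least (λ k → walk? G k u root) (proj₂ (reach⇒walk (reach u)))

  depth : Fin n → ℕ
  depth u = Least.value (toRoot u)

  firstStep : ∀ {u} → Least (λ k → Walk G k u root) → Fin n
  firstStep record { value = zero }                  = root
  firstStep record { value = suc _ ; holds = x , _ } = x

  firstStep-spec : ∀ {u} (l : Least (λ k → Walk G k u root)) → u ≢ root →
                   adj G u (firstStep l) ≡ true × depth (firstStep l) < Least.value l
  firstStep-spec record { value = zero ; holds = u≡root } u≢root = contradiction u≡root u≢root
  firstStep-spec record { value = suc _ ; holds = x , ux , walk } _ =
    ux , s≤s (Least.minimal (toRoot x) walk)

  -- Σ depth bounds every depth, so this rank increases towards the root.
  bfsTree : RootedSpanningTree G root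
  bfsTree = record
    { parent      = λ u → firstStep (toRoot u)
    ; rank        = λ u → sumFin depth ∸ depth u
    ; parent-adj  = λ {u} u≢root → proj₁ (firstStep-spec (toRoot u) u≢root)
    ; rank-parent = λ {u} u≢root →
        ∸-monoʳ-< (proj₂ (firstStep-spec (toRoot u) u≢root)) (≤-sumFin depth u)
    }

module TreeEdges {n} {G : Graph n} {root : Fin n} (T : RootedSpanningTree G root) where
  open RootedSpanningTree T

  rank-child : ∀ {j w} → j ≢ root → parent j ≡ w → rank j < rank w
  rank-child j≢root refl = rank-parent j≢root

  up : (Fin n → Bool) → Fin n → Bool
  up X i = not (does (i ≟ root)) ∧ X i

  up-nonRoot : ∀ X {w} → w ≢ root → up X w ≡ X w
  up-nonRoot X {w} w≢root = cong (λ b → not b ∧ X w) (dec-false (w ≟ root) w≢root)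

  arc : (Fin n → Bool) → Fin n → Fin n → Bool
  arc X i j = does (parent i ≟ j) ∧ up X i

  children : (Fin n → Bool) → Fin n → ℕ
  children X w = sumFin (λ j → ind (arc X j w))

  arc-spec : ∀ X i j → arc X i j ≡ true → i ≢ root × parent i ≡ j
  arc-spec X i j ij with parent i ≟ j | i ≟ root
  arc-spec X i j () | no _  | _
  arc-spec X i j () | yes _ | yes _
  ... | yes i↑j | no i≢root = i≢root , i↑j

  arc⇒adj : ∀ X i j → arc X i j ≡ true → adj G i j ≡ true
  arc⇒adj X i j ij with arc-spec X i j ij
  ... | i≢root , refl = parent-adj i≢root

  arc-asym : ∀ X i j → arc X i j ≡ true → arc X j i ≡ true → ⊥
  arc-asym X i j ij ji with arc-spec X i j ij | arc-spec X j i ji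
  ... | i≢root , refl | j≢root , j↑i = <-asym (rank-parent i≢root) (rank-child j≢root j↑i)

  children-cong : ∀ {X Y} w → (∀ j → j ≢ root → parent j ≡ w → X j ≡ Y j) →
                  children X w ≡ children Y w
  children-cong {X} {Y} w agree = sumFin-cong (λ j → cong ind (arc-cong j))
    where
    arc-cong : ∀ j → arc X j w ≡ arc Y j w
    arc-cong j with parent j ≟ w | j ≟ root
    ... | no _     | _         = refl
    ... | yes _    | yes _     = refl
    ... | yes j↑w  | no j≢root = agree j j≢root j↑w

  treeEdges : (Fin n → Bool) → EdgeSet G
  treeEdges X = record
    { mem    = λ i j → arc X i j ∨ arc X j i
    ; symS   = λ i j → ∨-comm (arc X i j) (arc X j i)
    ; subset = edge⇒adj
    }
    where
    edge⇒adj : ∀ i j → arc X i j ∨ arc X j i ≡ true → adj G i j ≡ true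
    edge⇒adj i j e with arc X i j in ij
    ... | true  = arc⇒adj X i j ij
    ... | false = trans (adj-sym G i j) (arc⇒adj X j i e)

  deg-treeEdges : ∀ X w → deg (mem (treeEdges X)) w ≡ ind (up X w) + children X w
  deg-treeEdges X w = begin
    sumFin (λ j → ind (arc X w j ∨ arc X j w))
      ≡⟨ sumFin-cong (λ j → ind-∨ (arc X w j) (arc X j w) (arc-asym X w j)) ⟩
    sumFin (λ j → ind (arc X w j) + ind (arc X j w))
      ≡⟨ sumFin-+ (λ j → ind (arc X w j)) (λ j → ind (arc X j w)) ⟩
    sumFin (λ j → ind (arc X w j)) + children X w
      ≡⟨ cong (_+ children X w) (sumFin-ind-≟ (parent w) (up X w)) ⟩
    ind (up X w) + children X w
      ∎
    where open ≡-Reasoning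

  card-treeEdges : ∀ X → card (treeEdges X) ≤ n ∸ 1
  card-treeEdges X = begin
    card (treeEdges X)                  ≤⟨ card-≤-arcs G (treeEdges X) (arc X) (λ _ _ → refl) ⟩
    sumFin² (λ i j → ind (arc X i j))   ≡⟨ sumFin-cong (λ i → sumFin-ind-≟ (parent i) (up X i)) ⟩
    sumFin (λ i → ind (up X i))         ≤⟨ sumFin-mono (λ i → ind-∧ (not (does (i ≟ root))) (X i)) ⟩
    sumFin (λ i → ind (not (does (i ≟ root))))  ≡⟨ sumFin-ind-≢ root ⟩
    n ∸ 1                               ∎
    where open ≤-Reasoning

  -- The parent edge of w can only be chosen once the edges below w are fixed:
  -- select f recurses from the leaves with fuel f and stabilises below rank f.
  module _ (δ : Fin n → Parity) where

    select : ℕ → Fin n → Bool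
    select zero    _ = false
    select (suc f) w = odd (δ w ⊕ parity (children (select f) w))

    select-stable : ∀ {f f′} w → rank w < f → rank w < f′ → select f w ≡ select f′ w
    select-stable {suc f} {suc f′} w (s≤s w≤f) (s≤s w≤f′) =
      cong (λ c → odd (δ w ⊕ parity c)) (children-cong w (λ j j≢root j↑w →
        select-stable j (<-≤-trans (rank-child j≢root j↑w) w≤f)
                        (<-≤-trans (rank-child j≢root j↑w) w≤f′)))

    chosen : Fin n → Bool
    chosen w = select (suc (rank w)) w

    chosen-unfold : ∀ w → chosen w ≡ odd (δ w ⊕ parity (children chosen w))
    chosen-unfold w = cong (λ c → odd (δ w ⊕ parity c)) (children-cong w (λ j j≢root j↑w →
      select-stable j (rank-child j≢root j↑w) ≤-refl))

    parity-chosen : ∀ w → w ≢ root → parity (deg (mem (treeEdges chosen)) w) ≡ δ w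
    parity-chosen w w≢root = begin
      parity (deg (mem (treeEdges chosen)) w)      ≡⟨ cong parity (deg-treeEdges chosen w) ⟩
      parity (ind (up chosen w) + c)               ≡⟨ +-homo-+ (ind (up chosen w)) c ⟩
      parity (ind (up chosen w)) ⊕ parity c        ≡⟨ cong (λ b → parity (ind b) ⊕ parity c)
                                                          (trans (up-nonRoot chosen w≢root) (chosen-unfold w)) ⟩
      parity (ind (odd (δ w ⊕ parity c))) ⊕ parity c  ≡⟨ cong (_⊕ parity c) (parity-ind-odd (δ w ⊕ parity c)) ⟩
      δ w ⊕ parity c ⊕ parity c                    ≡⟨ p+q+q≡p (δ w) (parity c) ⟩
      δ w                                          ∎
      where
      open ≡-Reasoning
      c = children chosen w

  treeEdges-realise : (δ : Fin n → Parity) →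
    ∃ λ X → ∀ w → w ≢ root → parity (deg (mem (treeEdges X)) w) ≡ δ w
  treeEdges-realise δ = chosen δ , parity-chosen δ

pendant-root-irregulator : ∀ {n} (G : Graph n) {root} → RootedSpanningTree G root →
  degree G root ≡ 1 → (τ : Fin n → Parity) → τ root ≡ 1ℙ →
  (∀ i j → adj G i j ≡ true → τ i ≢ τ j) → IeAtMost G (n ∸ 1)
pendant-root-irregulator {n} G {root} T deg-root≡1 τ τ-root τ-proper =
  S , irregular-by-parity (minus G S) τ (minus-sym G S)
        (λ i j ij → τ-proper i j (minus⊆adj G S ij)) parity-remaining
    , card-treeEdges X
  where
  open TreeEdges T
  x : Fin n → Parity
  x w = parity (degree G w)
  realised : ∃ λ X → ∀ w → w ≢ root → parity (deg (mem (treeEdges X)) w) ≡ τ w ⊕ x w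
  realised = treeEdges-realise (λ w → τ w ⊕ x w)
  X : Fin n → Bool
  X = proj₁ realised
  S : EdgeSet G
  S = treeEdges X

  at-root : ∀ {v j} → v ≡ root → minus G S v j ≡ true → parity (deg (minus G S) v) ≡ τ v
  at-root refl vj = trans (cong parity (deg-minus-pendant G S deg-root≡1 vj)) (sym τ-root)

  off-root : ∀ {v} → v ≢ root → parity (deg (minus G S) v) ≡ τ v
  off-root {v} v≢root = begin
    parity (deg (minus G S) v)      ≡⟨ parity-deg-minus G S v ⟩
    x v ⊕ parity (deg (mem S) v)    ≡⟨ ⊕-comm (x v) _ ⟩
    parity (deg (mem S) v) ⊕ x v    ≡⟨ cong (_⊕ x v) (proj₂ realised v v≢root) ⟩
    τ v ⊕ x v ⊕ x v                 ≡⟨ p+q+q≡p (τ v) (x v) ⟩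
    τ v                             ∎
    where open ≡-Reasoning

  parity-remaining : ∀ i j → minus G S i j ≡ true → parity (deg (minus G S) i) ≡ τ i
  parity-remaining i j ij = [ (λ i≡root → at-root i≡root ij) , off-root ]′ (toSum (i ≟ root))

sameColour : Bool → Bool → Parity
sameColour b₀ b = if does (b₀ ≟ᵇ b) then 1ℙ else 0ℙ

sameColour-refl : ∀ b → sameColour b b ≡ 1ℙ
sameColour-refl true  = refl
sameColour-refl false = refl

sameColour-injective : ∀ b₀ {b b′} → sameColour b₀ b ≡ sameColour b₀ b′ → b ≡ b′
sameColour-injective _     {true}  {true}  _ = refl
sameColour-injective _     {false} {false} _ = refl
sameColour-injective true  {true}  {false} ()
sameColour-injective true  {false} {true}  ()
sameColour-injective false {true}  {false} ()
sameColour-injective false {false} {true}  ()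

theorem6 : ∀ (n : ℕ) (G : Graph n) → Connected G → Bipartite G → MinDegreeOne G →
             IeAtMost G (n ∸ 1)
theorem6 n G connected (c , c-proper) (_ , v , deg-v≡1) =
  pendant-root-irregulator G tree deg-v≡1 (λ i → sameColour (c v) (c i)) (sameColour-refl (c v))
    (λ i j ij same → c-proper i j ij (sameColour-injective (c v) same))
  where
  tree : RootedSpanningTree G v
  tree = BreadthFirst.bfsTree G v (λ u → connected u v)
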